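{- Suppose $a_1P_{m_1}+a_2P_{m_2}$ is a node of depth $2$ in the escalator tree $T_\infty$. Then $a_1=1$ and $1\le a_2\le3$, and the truant $t(P_{m_1}+a_2P_{m_2})$ is as follows (rows indexed by $m_2$, listed for $m_2=3,4,5,7,8$ and $m_2\ge9$). For $a_2=1$, with columns $m_1=3,4,5,7,8,\ge9$: $m_2=3$: $5,8,9,9,12,5$; $m_2=4$: $8,3,20,3,3,3$; $m_2=5$: $9,20,11,10,4,4$; $m_2=7$: $9,3,10,3,3,3$; $m_2=8$: $12,3,4,3,3,3$; $m_2\ge9$: $5,3,4,3,3,3$. For $a_2=2$, with columns $m_1=3,4,5,7,8,9,\ge10$: $m_2=3$: $4,5,10,5,4,4,4$; $m_2=4$: $4,5,6,5,4,4,4$; $m_2=5$: $9,7,8,12,6,7,6$; $m_2=7$: $4,5,6,5,4,4,4$; $m_2=8$: $4,5,6,5,4,4,4$; $m_2\ge9$: $4,5,6,5,4,4,4$. For $a_2=3$ (where $m_1=5$): $m_2=3$: $6$; $m_2=4$: $6$; $m_2=5$: $9$; $m_2=7$: $6$; $m_2=8$: $6$; $m_2\ge9$: $6$.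
   Context: For $m\ge3$, $P_m(x)=\frac{(m-2)x^2-(m-4)x}{2}$ ($x\in\mathbb{Z}$). A sum of generalized polygonal numbers is $F=a_1P_{m_1}+\cdots+a_rP_{m_r}$ (a function of $(x_1,\dots,x_r)\in\mathbb{Z}^r$) with integers $1\le a_1\le\dots\le a_r$, $m_i\ge3$; it represents $n$ if $n=F(x)$ for some $x$, and is universal if it represents all positive integers. The truant $t(F)$ is the least positive integer not represented ($\infty$ if universal). The escalator tree $T_\infty$ is the rooted tree with root the empty sum $F=0$ (depth $0$, truant $1$); universal nodes are leaves; the children of a node $F=\sum_{j=1}^ra_jP_{m_j}$ with $t(F)<\infty$ are all sums $F+a_{r+1}P_{m_{r+1}}$ with $a_r\le a_{r+1}\le t(F)$, $m_{r+1}\ge3$, $m_{r+1}\ne6$, and $m_r\le m_{r+1}$ if $a_r=a_{r+1}$ (the children of the root are the $P_{m_1}$ with $m_1\ne 6$). A node of depth $r$ has $r$ summands. -}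

module Defs where

open import Data.Nat as ℕ using (ℕ; zero; suc; _∸_; _≤_; _<_)
open import Data.Integer as ℤ using (ℤ; +_)
open import Data.Integer.DivMod using (_/ℕ_)
open import Data.Fin using (Fin; #_)
open import Data.Vec using (Vec; []; _∷_; lookup)
open import Data.List using (List; []; _∷_; length)
open import Data.Product using (_×_; _,_; Σ)
open import Relation.Binary.PropositionalEquality using (_≡_; _≢_)
open import Relation.Nullary using (¬_)

-- Generalized m-gonal number P_m(x) = ((m-2)x² - (m-4)x)/2  (x ∈ ℤ).
-- The numerator is always even, so the division is exact.
P : ℕ → ℤ → ℤ
P m x = ((+ (m ∸ 2)) ℤ.* x ℤ.* x ℤ.- (+ m ℤ.- + 4) ℤ.* x) /ℕ 2

-- A sum of generalized polygonal numbers a₁P_{m₁}+⋯+a_rP_{m_r} is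
-- encoded as a list of pairs (a , m).  The list is stored in REVERSE
-- order: the head is the LAST summand (a_r , m_r).  (Order is
-- irrelevant for the value/representation; it only matters for the
-- escalator tree construction.)
Form : Set
Form = List (ℕ × ℕ)

eval : (F : Form) → Vec ℤ (length F) → ℤ
eval [] [] = + 0
eval ((a , m) ∷ F) (x ∷ xs) = + a ℤ.* P m x ℤ.+ eval F xs

Represents : Form → ℕ → Set
Represents F n = Σ (Vec ℤ (length F)) λ xs → eval F xs ≡ + n

IsTruant : Form → ℕ → Set
IsTruant F t = (1 ≤ t) × ¬ Represents F t × (∀ n → 1 ≤ n → n < t → Represents F n)

data Node : Form → Set where
  root  : Node []
  -- children of the root: P_{m₁}, m₁ ≥ 3, m₁ ≠ 6
  -- (equivalently a₁ with 1 ≤ a₁ ≤ t(0) = 1).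
  child₁ : ∀ {a m} → 1 ≤ a → a ≤ 1 → 3 ≤ m → m ≢ 6 → Node ((a , m) ∷ [])
  childₛ : ∀ {F a' m' a m t} → Node ((a' , m') ∷ F) → IsTruant ((a' , m') ∷ F) t →
           a' ≤ a → a ≤ t → 3 ≤ m → m ≢ 6 → (a' ≡ a → m' ≤ m) →
           Node ((a , m) ∷ (a' , m') ∷ F)

-- Column/row classes of the tables.
-- class6 : 3,4,5,7,8,≥9 ↦ 0,…,5  (values m ∈ {0,1,2,6} never occur in nodes)
class6 : ℕ → Fin 6
class6 3 = # 0
class6 4 = # 1
class6 5 = # 2
class6 7 = # 3
class6 8 = # 4
class6 _ = # 5

class7 : ℕ → Fin 7
class7 3 = # 0
class7 4 = # 1
class7 5 = # 2
class7 7 = # 3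
class7 8 = # 4
class7 9 = # 5
class7 _ = # 6

table1 : Vec (Vec ℕ 6) 6
table1 = (5 ∷ 8 ∷ 9 ∷ 9 ∷ 12 ∷ 5 ∷ [])
       ∷ (8 ∷ 3 ∷ 20 ∷ 3 ∷ 3 ∷ 3 ∷ [])
       ∷ (9 ∷ 20 ∷ 11 ∷ 10 ∷ 4 ∷ 4 ∷ [])
       ∷ (9 ∷ 3 ∷ 10 ∷ 3 ∷ 3 ∷ 3 ∷ [])
       ∷ (12 ∷ 3 ∷ 4 ∷ 3 ∷ 3 ∷ 3 ∷ [])
       ∷ (5 ∷ 3 ∷ 4 ∷ 3 ∷ 3 ∷ 3 ∷ [])
       ∷ []

table2 : Vec (Vec ℕ 7) 6
table2 = (4 ∷ 5 ∷ 10 ∷ 5 ∷ 4 ∷ 4 ∷ 4 ∷ [])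
       ∷ (4 ∷ 5 ∷ 6 ∷ 5 ∷ 4 ∷ 4 ∷ 4 ∷ [])
       ∷ (9 ∷ 7 ∷ 8 ∷ 12 ∷ 6 ∷ 7 ∷ 6 ∷ [])
       ∷ (4 ∷ 5 ∷ 6 ∷ 5 ∷ 4 ∷ 4 ∷ 4 ∷ [])
       ∷ (4 ∷ 5 ∷ 6 ∷ 5 ∷ 4 ∷ 4 ∷ 4 ∷ [])
       ∷ (4 ∷ 5 ∷ 6 ∷ 5 ∷ 4 ∷ 4 ∷ 4 ∷ [])
       ∷ []

table3 : Vec ℕ 6
table3 = 6 ∷ 6 ∷ 9 ∷ 6 ∷ 6 ∷ 6 ∷ []

-- The tabulated truant t(P_{m₁} + a₂ P_{m₂}) as a function of m₁, a₂, m₂.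
-- (Value 0 outside the tabulated range; such triples never occur as nodes
-- by the first part of the proposition.)
truantTable : ℕ → ℕ → ℕ → ℕ
truantTable m₁ 1 m₂ = lookup (lookup table1 (class6 m₂)) (class6 m₁)
truantTable m₁ 2 m₂ = lookup (lookup table2 (class6 m₂)) (class7 m₁)
truantTable 5  3 m₂ = lookup table3 (class6 m₂)
truantTable _  _ _  = 0

{-# OPTIONS --safe #-}
-- For m ≥ 3 the generalized polygonal number P_m(x) is a natural number of size at least
-- |x| − 1, so a form with positive coefficients represents n only through arguments with
-- |x| ≤ n + 1; representability, and hence "t is the truant", is decidable by a finite
-- search.  A depth-2 node has a₁ = 1 and a₂ ≤ t(P_{m₁}) ≤ 3, which leaves finitely many
-- cases apart from the unbounded indices m ≥ 10; for those, 0 and 1 are the only values of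
-- P_m below 7, and every tabulated truant involving them is at most 6.
module Submission where

open import Defs
open import Data.Nat as ℕ using (ℕ; zero; suc; _∸_; _≤_; s≤s; z≤n; _≤?_)
import Data.Nat.Properties as ℕₚ
open import Data.Nat.DivMod using (m*n/n≡m)
open import Data.Integer as ℤ using (ℤ; +_; -[1+_])
import Data.Integer.Properties as ℤₚ
open import Data.Integer.Tactic.RingSolver using (solve-∀)
open import Data.Nat.Tactic.RingSolver renaming (solve-∀ to ℕ-solve-∀)
open import Data.Bool using (if_then_else_; true; false)
open import Data.Empty using (⊥-elim)
open import Data.List using (List; []; _∷_; _++_; map; upTo; applyUpTo; length)
open import Data.List.Relation.Unary.All as All using (All; []; _∷_)
open import Data.List.Relation.Unary.Any using (Any; here; there; any?; satisfied)
open import Data.List.Membership.Propositional using (_∈_; lose)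
open import Data.List.Membership.Propositional.Properties using (∈-map⁺; ∈-++⁺ˡ; ∈-++⁺ʳ; ∈-upTo⁺; ∈-applyUpTo⁺)
open import Data.Vec using (Vec; []; _∷_)
open import Data.Product using (Σ; _×_; _,_; proj₁; proj₂)
open import Function using (_∘_)
open import Relation.Binary.PropositionalEquality
open import Relation.Nullary using (Dec; yes; no)
open import Relation.Nullary.Decidable using (map′; _×-dec_; _→-dec_; ¬?; from-yes)
open import Relation.Unary using (Decidable)

triangular : ℕ → ℕ
triangular zero = 0
triangular (suc k) = suc k ℕ.+ triangular k

-- P_m(j+1) = (j+1) + (m−2)T_j and P_m(−(k+1)) = (k+1)(m−3) + (m−2)T_k; for m < 3 the
-- truncated subtractions make this differ from P_m.
polygonal : ℕ → ℤ → ℕ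
polygonal m (+ zero) = 0
polygonal m (+ suc j) = suc j ℕ.+ triangular j ℕ.* (m ∸ 2)
polygonal m -[1+ k ] = suc k ℕ.* (m ∸ 3) ℕ.+ triangular k ℕ.* (m ∸ 2)

triangular-double : ∀ k → triangular k ℕ.+ triangular k ≡ k ℕ.* suc k
triangular-double zero = refl
triangular-double (suc k) = begin
  (suc k ℕ.+ T) ℕ.+ (suc k ℕ.+ T)       ≡⟨ regroup (suc k) T ⟩
  suc k ℕ.+ suc k ℕ.+ (T ℕ.+ T)         ≡⟨ cong (suc k ℕ.+ suc k ℕ.+_) (triangular-double k) ⟩
  suc k ℕ.+ suc k ℕ.+ k ℕ.* suc k       ≡⟨ step k ⟩
  suc k ℕ.* suc (suc k)                 ∎
  where
  open ≡-Reasoning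
  T = triangular k
  regroup : ∀ a b → (a ℕ.+ b) ℕ.+ (a ℕ.+ b) ≡ a ℕ.+ a ℕ.+ (b ℕ.+ b)
  regroup = ℕ-solve-∀
  step : ∀ k → suc k ℕ.+ suc k ℕ.+ k ℕ.* suc k ≡ suc k ℕ.* suc (suc k)
  step = ℕ-solve-∀

module _ where
  open import Data.Integer using (_+_; _*_; _-_; -_)

  private
    triangular-doubleℤ : ∀ k → + k * (+ 1 + + k) ≡ + triangular k + + triangular k
    triangular-doubleℤ k = begin
      + k * + suc k                           ≡⟨ ℤₚ.pos-* k (suc k) ⟨
      + (k ℕ.* suc k)                         ≡⟨ cong +_ (triangular-double k) ⟨
      + (triangular k ℕ.+ triangular k)       ≡⟨ ℤₚ.pos-+ (triangular k) _ ⟩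
      + triangular k + + triangular k         ∎
      where open ≡-Reasoning

    expand₀ : ∀ N → (+ 1 + N) * + 0 * + 0 - ((+ 3 + N) - + 4) * + 0 ≡ + 0 * + 2
    expand₀ = solve-∀

    expand₊ : ∀ J N → (+ 1 + N) * (+ 1 + J) * (+ 1 + J) - ((+ 3 + N) - + 4) * (+ 1 + J)
                      ≡ (+ 1 + J) * + 2 + J * (+ 1 + J) * (+ 1 + N)
    expand₊ = solve-∀

    expand₋ : ∀ K N → (+ 1 + N) * - (+ 1 + K) * - (+ 1 + K) - ((+ 3 + N) - + 4) * - (+ 1 + K)
                      ≡ (+ 1 + K) * N * + 2 + K * (+ 1 + K) * (+ 1 + N)
    expand₋ = solve-∀

    factor-2 : ∀ A T M → A * + 2 + (T + T) * M ≡ (A + T * M) * + 2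
    factor-2 = solve-∀

  numerator≡double : ∀ n x → + suc n * x * x - (+ (3 ℕ.+ n) - + 4) * x ≡ + polygonal (3 ℕ.+ n) x * + 2
  numerator≡double n (+ zero) = expand₀ (+ n)
  numerator≡double n (+ suc j) = begin
    _                                           ≡⟨ expand₊ (+ j) (+ n) ⟩
    + suc j * + 2 + + j * + suc j * + suc n     ≡⟨ cong (λ z → + suc j * + 2 + z * + suc n) (triangular-doubleℤ j) ⟩
    + suc j * + 2 + (+ T + + T) * + suc n       ≡⟨ factor-2 (+ suc j) (+ T) (+ suc n) ⟩
    (+ suc j + + T * + suc n) * + 2             ≡⟨ cong (_* + 2) cast ⟨
    + (suc j ℕ.+ T ℕ.* suc n) * + 2             ∎
    where
    open ≡-Reasoning
    T = triangular j
    cast : + (suc j ℕ.+ T ℕ.* suc n) ≡ + suc j + + T * + suc n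
    cast = trans (ℤₚ.pos-+ (suc j) _) (cong (_+_ (+ suc j)) (ℤₚ.pos-* T (suc n)))
  numerator≡double n -[1+ k ] = begin
    _                                                ≡⟨ expand₋ (+ k) (+ n) ⟩
    + suc k * + n * + 2 + + k * + suc k * + suc n    ≡⟨ cong (λ z → + suc k * + n * + 2 + z * + suc n) (triangular-doubleℤ k) ⟩
    + suc k * + n * + 2 + (+ T + + T) * + suc n      ≡⟨ factor-2 (+ suc k * + n) (+ T) (+ suc n) ⟩
    (+ suc k * + n + + T * + suc n) * + 2            ≡⟨ cong (_* + 2) cast ⟨
    + (suc k ℕ.* n ℕ.+ T ℕ.* suc n) * + 2            ∎
    where
    open ≡-Reasoning
    T = triangular k
    cast : + (suc k ℕ.* n ℕ.+ T ℕ.* suc n) ≡ + suc k * + n + + T * + suc n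
    cast = trans (ℤₚ.pos-+ (suc k ℕ.* n) _) (cong₂ _+_ (ℤₚ.pos-* (suc k) n) (ℤₚ.pos-* T (suc n)))

P≡polygonal : ∀ {m} → 3 ≤ m → ∀ x → P m x ≡ + polygonal m x
P≡polygonal {suc (suc (suc n))} (s≤s (s≤s (s≤s _))) x = begin
  P (3 ℕ.+ n) x                       ≡⟨ cong (ℤ._/ℕ 2) (numerator≡double n x) ⟩
  (+ v ℤ.* + 2) ℤ./ℕ 2                ≡⟨ cong (ℤ._/ℕ 2) (ℤₚ.pos-* v 2) ⟨
  + (v ℕ.* 2 ℕ./ 2)                   ≡⟨ cong +_ (m*n/n≡m v 2) ⟩
  + v                                 ∎
  where
  open ≡-Reasoning
  v = polygonal (3 ℕ.+ n) x

window : ℕ → List ℤ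
window n = map +_ (upTo (suc n)) ++ map -[1+_] (upTo (suc n))

k≤triangular : ∀ k → k ≤ triangular k
k≤triangular zero = z≤n
k≤triangular (suc k) = s≤s (ℕₚ.m≤m+n k (triangular k))

∈-window : ∀ {m n} → 3 ≤ m → ∀ x → polygonal m x ≤ n → x ∈ window n
∈-window {n = n} _ (+ zero) _ = ∈-++⁺ˡ (∈-map⁺ +_ (∈-upTo⁺ {suc n} (s≤s z≤n)))
∈-window _ (+ suc j) le = ∈-++⁺ˡ (∈-map⁺ +_ (∈-upTo⁺ (s≤s (ℕₚ.≤-trans (ℕₚ.m≤m+n (suc j) _) le))))
∈-window {suc (suc (suc m))} {n} (s≤s (s≤s (s≤s _))) -[1+ k ] le =
  ∈-++⁺ʳ (map +_ (upTo (suc n))) (∈-map⁺ -[1+_] (∈-upTo⁺ (s≤s k≤n)))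
  where
  open ℕₚ.≤-Reasoning
  k≤n : k ≤ n
  k≤n = begin
    k                                 ≤⟨ k≤triangular k ⟩
    triangular k                      ≤⟨ ℕₚ.m≤m*n (triangular k) (suc m) ⟩
    triangular k ℕ.* suc m            ≤⟨ ℕₚ.m≤n+m _ (suc k ℕ.* m) ⟩
    polygonal (3 ℕ.+ m) -[1+ k ]      ≤⟨ le ⟩
    n                                 ∎

Admissible : Form → Set
Admissible = All (λ (a , m) → 1 ≤ a × 3 ≤ m)

admissible? : Decidable Admissible
admissible? = All.all? (λ (a , m) → 1 ≤? a ×-dec 3 ≤? m)

value : (F : Form) → Vec ℤ (length F) → ℕ
value [] [] = 0
value ((a , m) ∷ F) (x ∷ xs) = a ℕ.* polygonal m x ℕ.+ value F xs

eval≡value : ∀ {F} → Admissible F → ∀ xs → eval F xs ≡ + value F xs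
eval≡value [] [] = refl
eval≡value {(a , m) ∷ F} ((_ , 3≤m) ∷ adm) (x ∷ xs) = begin
  + a ℤ.* P m x ℤ.+ eval F xs ≡⟨ cong₂ (λ p e → + a ℤ.* p ℤ.+ e) (P≡polygonal 3≤m x) (eval≡value adm xs) ⟩
  + a ℤ.* + polygonal m x ℤ.+ + value F xs ≡⟨ cong (ℤ._+ + value F xs) (ℤₚ.pos-* a (polygonal m x)) ⟨
  + (a ℕ.* polygonal m x) ℤ.+ + value F xs ∎
  where open ≡-Reasoning

ValueRepresents : Form → ℕ → Set
ValueRepresents F n = Σ (Vec ℤ (length F)) λ xs → value F xs ≡ n

valueRepresents⇒represents : ∀ {F n} → Admissible F → ValueRepresents F n → Represents F n
valueRepresents⇒represents adm (xs , e) = xs , trans (eval≡value adm xs) (cong +_ e)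

represents⇒valueRepresents : ∀ {F n} → Admissible F → Represents F n → ValueRepresents F n
represents⇒valueRepresents adm (xs , e) = xs , ℤₚ.+-injective (trans (sym (eval≡value adm xs)) e)

valueRepresents? : ∀ {F} → Admissible F → Decidable (ValueRepresents F)
valueRepresents? [] n = map′ (λ { refl → [] , refl }) (λ { ([] , e) → e }) (0 ℕ.≟ n)
valueRepresents? {(suc a , m) ∷ F} ((_ , 3≤m) ∷ adm) n =
  map′ fromAny toAny (any? (λ x → summand x ≤? n ×-dec valueRepresents? adm (n ∸ summand x)) (window n))
  where
  summand : ℤ → ℕ
  summand x = suc a ℕ.* polygonal m x
  fromAny : Any (λ x → summand x ≤ n × ValueRepresents F (n ∸ summand x)) (window n) → ValueRepresents ((suc a , m) ∷ F) n
  fromAny any with satisfied any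
  ... | x , le , xs , e = x ∷ xs , trans (cong (summand x ℕ.+_) e) (ℕₚ.m+[n∸m]≡n le)
  toAny : ValueRepresents ((suc a , m) ∷ F) n → Any (λ x → summand x ≤ n × ValueRepresents F (n ∸ summand x)) (window n)
  toAny (x ∷ xs , e) = lose (∈-window 3≤m x (ℕₚ.≤-trans (ℕₚ.m≤n*m _ (suc a)) le)) (le , xs , rest)
    where
    le : summand x ≤ n
    le = subst (summand x ≤_) e (ℕₚ.m≤m+n _ _)
    rest : value F xs ≡ n ∸ summand x
    rest = trans (sym (ℕₚ.m+n∸m≡n (summand x) _)) (cong (_∸ summand x) e)

represents? : ∀ {F} → Admissible F → Decidable (Represents F)
represents? adm n =
  map′ (valueRepresents⇒represents adm) (represents⇒valueRepresents adm) (valueRepresents? adm n)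

isTruant? : ∀ {F} → Admissible F → Decidable (IsTruant F)
isTruant? adm t =
  1 ≤? t ×-dec ¬? (represents? adm t) ×-dec
  map′ (λ h n 1≤n n<t → h n<t 1≤n) (λ h {n} n<t 1≤n → h n 1≤n n<t) (ℕₚ.allUpTo? (λ n → 1 ≤? n →-dec represents? adm n) t)

admissibleTruant? : ∀ F t → Dec (Admissible F × IsTruant F t)
admissibleTruant? F t with admissible? F
... | yes adm = map′ (adm ,_) proj₂ (isTruant? adm t)
... | no ¬adm = no (¬adm ∘ proj₁)

indices : ℕ → List ℕ
indices j = 3 ∷ 4 ∷ 5 ∷ 7 ∷ 8 ∷ 9 ∷ 10 ℕ.+ j ∷ []

monomialTruant : ℕ → ℕ
monomialTruant m = if m ℕ.≡ᵇ 5 then 3 else 2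

coefficients : ℕ → List ℕ
coefficients m = applyUpTo suc (monomialTruant m)

monomial : ℕ → Form
monomial m = (1 , m) ∷ []

binomial : ℕ → ℕ → ℕ → Form
binomial m₁ a m₂ = (a , m₂) ∷ (1 , m₁) ∷ []

monomial-truants : ∀ j → All (λ m → Admissible (monomial m) × IsTruant (monomial m) (monomialTruant m)) (indices j)
monomial-truants j = from-yes (All.all? (λ m → admissibleTruant? (monomial m) (monomialTruant m)) (indices j))

-- The decision procedures reduce with j and k unknown: every value of P_{10+j} other than
-- 0 and 1 is at least 7, and it is only ever compared with numbers up to the truant, which
-- is at most 6 whenever 10 + j or 10 + k occurs.
binomial-truants : ∀ j k →
  All (λ m₁ → All (λ a → All (λ m₂ → Admissible (binomial m₁ a m₂) × IsTruant (binomial m₁ a m₂) (truantTable m₁ a m₂))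
    (indices k)) (coefficients m₁)) (indices j)
binomial-truants j k = from-yes
  (All.all? (λ m₁ → All.all? (λ a → All.all? (λ m₂ → admissibleTruant? (binomial m₁ a m₂) (truantTable m₁ a m₂))
    (indices k)) (coefficients m₁)) (indices j))

index-cover : ∀ {m} → 3 ≤ m → m ≢ 6 → Σ ℕ λ j → m ∈ indices j
index-cover {1} (s≤s ()) _
index-cover {2} (s≤s (s≤s ())) _
index-cover {3} _ _ = 0 , here refl
index-cover {4} _ _ = 0 , there (here refl)
index-cover {5} _ _ = 0 , there (there (here refl))
index-cover {6} _ 6≢6 = ⊥-elim (6≢6 refl)
index-cover {7} _ _ = 0 , there (there (there (here refl)))
index-cover {8} _ _ = 0 , there (there (there (there (here refl))))
index-cover {9} _ _ = 0 , there (there (there (there (there (here refl)))))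
index-cover {suc (suc (suc (suc (suc (suc (suc (suc (suc (suc j)))))))))} _ _ =
  j , there (there (there (there (there (there (here refl))))))

truant-unique : ∀ {F t t′} → IsTruant F t → IsTruant F t′ → t ≡ t′
truant-unique (1≤t , ¬Rt , below) (1≤t′ , ¬Rt′ , below′) =
  ℕₚ.≤-antisym (ℕₚ.≮⇒≥ (λ t′<t → ¬Rt′ (below _ 1≤t′ t′<t))) (ℕₚ.≮⇒≥ (λ t<t′ → ¬Rt (below′ _ 1≤t t<t′)))

monomialTruant≤3 : ∀ m → monomialTruant m ≤ 3
monomialTruant≤3 m with m ℕ.≡ᵇ 5
... | true = ℕₚ.≤-refl
... | false = s≤s (s≤s z≤n)

∈-coefficients : ∀ {a m} → 1 ≤ a → a ≤ monomialTruant m → a ∈ coefficients m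
∈-coefficients {suc a} _ a<t = ∈-applyUpTo⁺ suc a<t

proposition2p2 : ∀ (a₁ m₁ a₂ m₂ : ℕ) →
    Node ((a₂ , m₂) ∷ (a₁ , m₁) ∷ []) →
    (a₁ ≡ 1) × (1 ≤ a₂) × (a₂ ≤ 3) ×
    IsTruant ((a₂ , m₂) ∷ (1 , m₁) ∷ []) (truantTable m₁ a₂ m₂)
proposition2p2 .1 m₁ a₂ m₂ (childₛ (child₁ (s≤s z≤n) (s≤s z≤n) 3≤m₁ m₁≢6) t₁-truant 1≤a₂ a₂≤t₁ 3≤m₂ m₂≢6 _)
  with index-cover 3≤m₁ m₁≢6 | index-cover 3≤m₂ m₂≢6
... | j , m₁∈ | k , m₂∈ =
  refl , 1≤a₂ , ℕₚ.≤-trans a₂≤tP (monomialTruant≤3 m₁) ,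
  proj₂ (All.lookup (All.lookup (All.lookup (binomial-truants j k) m₁∈) a₂∈) m₂∈)
  where
  a₂≤tP : a₂ ≤ monomialTruant m₁
  a₂≤tP = subst (a₂ ≤_) (truant-unique t₁-truant (proj₂ (All.lookup (monomial-truants j) m₁∈))) a₂≤t₁
  a₂∈ : a₂ ∈ coefficients m₁
  a₂∈ = ∈-coefficients {m = m₁} 1≤a₂ a₂≤tP
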